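{- If a multiplier $-\ltimes U:\mathcal W\to\mathcal V$ is affine, then it is elementally affine: for every presheaf $\Psi$ on $\mathcal W$ and every $W\in\mathcal W$, the map $\Psi(W)\to\{\varphi\in(\Psi\ltimes\mathbf yU)(W\ltimes U)\mid\pi_2\circ\varphi=\pi_2\}$, $\psi\mapsto\psi\ltimes\mathbf yU$, is surjective.
   Context: $\mathcal W$ has a terminal object $\top$. A multiplier for $U\in\mathcal V$ is a functor $-\ltimes U:\mathcal W\to\mathcal V$ with an isomorphism $\top\ltimes U\cong U$; $\pi_2:W\ltimes U\to U$ is $(!_W\ltimes U)$ followed by it. $\mathrm{Fr}_U:\mathcal W\to\mathcal V/U$, $W\mapsto(W\ltimes U,\pi_2)$, $f\mapsto f\ltimes U$; affine means $\mathrm{Fr}_U$ is full. For a presheaf $\Psi$ on $\mathcal W$, $\Psi\ltimes\mathbf yU$ is the presheaf on $\mathcal V$ with $(\Psi\ltimes\mathbf yU)(V)=\int^{W'}\mathcal V(V,W'\ltimes U)\times\Psi(W')$; the class of $(\chi,\psi)$ is written $(\psi\ltimes\mathbf yU)\circ\chi$, and $\psi\ltimes\mathbf yU$ abbreviates the class of $(\mathrm{id},\psi)$. $\pi_2\circ\varphi$ denotes the image of $\varphi$ under $\pi_2:\Psi\ltimes\mathbf yU\to\mathbf yU$, which sends $(\psi\ltimes\mathbf yU)\circ\chi$ to $\pi_2\circ\chi$. -}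

module Defs where

open import Level using (Level; _⊔_; suc)
open import Data.Product using (Σ; _×_; _,_; ∃)
open import Relation.Binary.PropositionalEquality using (_≡_)
open import Relation.Binary.Construct.Closure.Equivalence using (EqClosure)

record Category (o ℓ : Level) : Set (suc (o ⊔ ℓ)) where
  infixr 9 _∘_
  field
    Obj : Set o
    Hom : Obj → Obj → Set ℓ
    id  : ∀ {A} → Hom A A
    _∘_ : ∀ {A B C} → Hom B C → Hom A B → Hom A C
    identityˡ : ∀ {A B} {f : Hom A B} → id ∘ f ≡ f
    identityʳ : ∀ {A B} {f : Hom A B} → f ∘ id ≡ f
    assoc : ∀ {A B C D} {f : Hom A B} {g : Hom B C} {h : Hom C D} →
            (h ∘ g) ∘ f ≡ h ∘ (g ∘ f)

record Functor {o ℓ o' ℓ'} (C : Category o ℓ) (D : Category o' ℓ')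
       : Set (o ⊔ ℓ ⊔ o' ⊔ ℓ') where
  private
    module C = Category C
    module D = Category D
  field
    F₀ : C.Obj → D.Obj
    F₁ : ∀ {A B} → C.Hom A B → D.Hom (F₀ A) (F₀ B)
    F-id : ∀ {A} → F₁ (C.id {A}) ≡ D.id
    F-∘  : ∀ {A B E} {f : C.Hom A B} {g : C.Hom B E} →
           F₁ (g C.∘ f) ≡ F₁ g D.∘ F₁ f

record Terminal {o ℓ} (C : Category o ℓ) : Set (o ⊔ ℓ) where
  open Category C
  field
    ⊤ : Obj
    ! : ∀ {A} → Hom A ⊤
    !-unique : ∀ {A} (f : Hom A ⊤) → f ≡ !

record Presheaf {o ℓ} (C : Category o ℓ) (p : Level) : Set (o ⊔ ℓ ⊔ suc p) where
  open Category C
  field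
    P₀ : Obj → Set p
    P₁ : ∀ {A B} → Hom A B → P₀ B → P₀ A
    P-id : ∀ {A} (x : P₀ A) → P₁ id x ≡ x
    P-∘  : ∀ {A B E} (f : Hom A B) (g : Hom B E) (x : P₀ E) →
           P₁ (g ∘ f) x ≡ P₁ f (P₁ g x)

module _ {o ℓ o' ℓ'} {𝒲 : Category o ℓ} {𝒱 : Category o' ℓ'} (T : Terminal 𝒲) where
  private
    module W = Category 𝒲
    module V = Category 𝒱
  open Terminal T

  record Multiplier (U : V.Obj) : Set (o ⊔ ℓ ⊔ o' ⊔ ℓ') where
    field
      ⋉U : Functor 𝒲 𝒱
    open Functor ⋉U public
    field
      unit    : V.Hom (F₀ ⊤) U
      unit⁻¹  : V.Hom U (F₀ ⊤)
      unit-isoˡ : unit V.∘ unit⁻¹ ≡ V.id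
      unit-isoʳ : unit⁻¹ V.∘ unit ≡ V.id

    π₂ : (X : W.Obj) → V.Hom (F₀ X) U
    π₂ X = unit V.∘ F₁ (! {X})

    -- Affine: Fr_U : 𝒲 → 𝒱/U is full.  A morphism (X⋉U, π₂) → (Y⋉U, π₂)
    -- in the slice is g with π₂ ∘ g = π₂; Fr_U f has underlying map f ⋉ U.
    Affine : Set (o ⊔ ℓ ⊔ ℓ')
    Affine = ∀ {X Y : W.Obj} (g : V.Hom (F₀ X) (F₀ Y)) →
             π₂ Y V.∘ g ≡ π₂ X → ∃ λ (f : W.Hom X Y) → F₁ f ≡ g

    module _ {p} (Ψ : Presheaf 𝒲 p) where
      open Presheaf Ψ

      -- Representatives of elements of (Ψ ⋉ yU)(A) = ∫^{W'} 𝒱(A, W'⋉U) × Ψ(W').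
      Rep : V.Obj → Set (o ⊔ ℓ' ⊔ p)
      Rep A = Σ W.Obj λ W' → V.Hom A (F₀ W') × P₀ W'

      data Step {A : V.Obj} : Rep A → Rep A → Set (o ⊔ ℓ ⊔ ℓ' ⊔ p) where
        step : ∀ {W₁ W₂} (f : W.Hom W₁ W₂) (χ : V.Hom A (F₀ W₁)) (ψ : P₀ W₂) →
               Step (W₁ , χ , P₁ f ψ) (W₂ , F₁ f V.∘ χ , ψ)

      _≈ᶜ_ : {A : V.Obj} → Rep A → Rep A → Set (o ⊔ ℓ ⊔ ℓ' ⊔ p)
      _≈ᶜ_ = EqClosure Step

      -- π₂ ∘ φ  (well defined on classes), computed on a representative.
      π₂∘ : {A : V.Obj} → Rep A → V.Hom A U
      π₂∘ (W' , χ , ψ) = π₂ W' V.∘ χ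

      _⋉y : {X : W.Obj} → P₀ X → Rep (F₀ X)
      _⋉y {X} ψ = X , V.id , ψ

      ElementallySurjective : W.Obj → Set (o ⊔ ℓ ⊔ ℓ' ⊔ p)
      ElementallySurjective X =
        (φ : Rep (F₀ X)) → π₂∘ φ ≡ π₂ X → ∃ λ (ψ : P₀ X) → (ψ ⋉y) ≈ᶜ φ

    ElementallyAffine : (p : Level) → Set (o ⊔ ℓ ⊔ ℓ' ⊔ suc p)
    ElementallyAffine p = (Ψ : Presheaf 𝒲 p) (X : W.Obj) → ElementallySurjective Ψ X

{-# OPTIONS --safe #-}
module Submission where

open import Defs
open import Level using (Level)
open import Relation.Binary.PropositionalEquality using (_≡_; refl; subst)
open import Data.Product using (_,_)
open import Relation.Binary.Construct.Closure.ReflexiveTransitive using (return)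
open import Relation.Binary.Construct.Closure.Symmetric using (fwd)

-- An element φ of (Ψ ⋉ yU)(X ⋉ U) is represented by some (χ : X ⋉ U → W' ⋉ U, ψ).
-- If π₂ ∘ χ = π₂, affineness writes χ = f ⋉ U, and then the coend relation
-- identifies (f ⋉ U, ψ) with (id, Ψ(f) ψ), i.e. φ = Ψ(f) ψ ⋉ yU.

module _ {o ℓ o' ℓ'} {𝒲 : Category o ℓ} {𝒱 : Category o' ℓ'}
         (T : Terminal 𝒲) (U : Category.Obj 𝒱) (M : Multiplier {𝒱 = 𝒱} T U) where
  private
    module W = Category 𝒲
    module V = Category 𝒱
  open Multiplier M

  restriction-⋉y : ∀ {p} (Ψ : Presheaf 𝒲 p) {X W' : W.Obj} (f : W.Hom X W')
                   (ψ : Presheaf.P₀ Ψ W') →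
                   _≈ᶜ_ Ψ (_⋉y Ψ (Presheaf.P₁ Ψ f ψ)) (W' , F₁ f , ψ)
  restriction-⋉y Ψ {X} {W'} f ψ =
    subst (λ χ → _≈ᶜ_ Ψ (X , V.id , Presheaf.P₁ Ψ f ψ) (W' , χ , ψ))
          V.identityʳ
          (return (fwd (step f V.id ψ)))

mainTheorem13 : ∀ {o ℓ o' ℓ'} {𝒲 : Category o ℓ} {𝒱 : Category o' ℓ'}
                  (T : Terminal 𝒲) (U : Category.Obj 𝒱) (M : Multiplier {𝒱 = 𝒱} T U) →
                  Multiplier.Affine M → (p : Level) → Multiplier.ElementallyAffine M p
mainTheorem13 T U M affine p Ψ X (W' , χ , ψ) π₂∘χ≡π₂ with affine χ π₂∘χ≡π₂
... | f , refl = Presheaf.P₁ Ψ f ψ , restriction-⋉y T U M Ψ f ψ
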